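{- Let $P$ be a non-empty finite set of primes and let $p,q\in P$ with $p<q$. Then the set $\{\|n\|_{P,\log} : n>1\}$ is dense in the interval $(\|p\|_{\log}, \|q\|_{\log})$, i.e. every non-empty open subinterval of it contains a value $\|n\|_{P,\log}$ for some integer $n>1$.
   Context: For a positive integer $m$, $\|m\|$ denotes the minimum number of occurrences of the constant $1$ in an arithmetic expression built only from the constant $1$, addition, multiplication and parentheses whose value is $m$; for $m>1$, $\|m\|_{\log}=\|m\|/\log_3 m$. Given a non-empty finite set $P$ of primes, the $P$-algorithm builds an expression for $n>0$ as follows: (1) if $n=1$, represent $n$ as $1$ and stop; (2) if $n=p\in P$, represent $n$ by a shortest expression of $p$ (with $\|p\|$ ones) and stop; (3) if $n>1$, $n\notin P$ and $n$ is divisible by some $p\in P$, represent $n$ as (shortest expression of $p$)$\cdot\frac{n}{p}$ and continue with $\frac{n}{p}$; (4) if $n>1$ and $n$ is divisible by no $p\in P$, represent $n$ as $1+(n-1)$ and continue with $n-1$. The number of ones in the resulting expression does not depend on the choices made in step (3); it is denoted $\|n\|_P$. Equivalently: $\|1\|_P=1$; $\|p\|_P=\|p\|$ for $p\in P$; $\|n\|_P=\|p\|+\|n/p\|_P$ if $n>1$, $n\notin P$, $p\in P$, $p\mid n$; $\|n\|_P = 1+\|n-1\|_P$ if $n>1$ is divisible by no element of $P$. For $n>1$, $\|n\|_{P,\log}=\|n\|_P/\log_3 n$. -}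

module Defs where

open import Data.Nat using (ℕ; zero; suc; _+_; _*_; _∸_; _≤_; _≤?_)
open import Data.Nat.Divisibility using (_∣_; _∣?_; quotient)
open import Data.List using (List; []; _∷_)
open import Data.List.Membership.DecPropositional (Data.Nat._≟_) using (_∈?_)
open import Data.Product using (Σ; _×_; _,_)
open import Relation.Binary.PropositionalEquality using (_≡_)
open import Relation.Nullary using (yes; no)
open import Data.Maybe using (Maybe; just; nothing)

data Expr : Set where
  one  : Expr
  _⊕_  : Expr → Expr → Expr
  _⊗_  : Expr → Expr → Expr

value : Expr → ℕ
value one     = 1
value (e ⊕ f) = value e + value f
value (e ⊗ f) = value e * value f

ones : Expr → ℕ
ones one     = 1
ones (e ⊕ f) = ones e + ones f
ones (e ⊗ f) = ones e + ones f

IsComplexity : ℕ → ℕ → Set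
IsComplexity m k =
  (Σ Expr λ e → value e ≡ m × ones e ≡ k) × ((e : Expr) → value e ≡ m → k ≤ ones e)

firstDivisor : List ℕ → ℕ → Maybe (ℕ × ℕ)
firstDivisor []      n = nothing
firstDivisor (p ∷ P) n with p ∣? n
... | yes p∣n = just (p , quotient p∣n)
... | no  _   = firstDivisor P n

-- The P-algorithm with fuel; cx is the complexity function ‖_‖.
pNormFuel : (ℕ → ℕ) → List ℕ → ℕ → ℕ → ℕ
pNormFuel cx P zero    n = 0
pNormFuel cx P (suc f) n with n ≤? 1
... | yes _ = 1
... | no  _ with n ∈? P
...   | yes _ = cx n
...   | no  _ with firstDivisor P n
...     | just (p , m) = cx p + pNormFuel cx P f m
...     | nothing      = 1 + pNormFuel cx P f (n ∸ 1)

-- ‖n‖_P (fuel n suffices for n ≥ 1, since every step strictly decreases n).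
pNorm : (ℕ → ℕ) → List ℕ → ℕ → ℕ
pNorm cx P n = pNormFuel cx P n n

{-# OPTIONS --safe #-}
module Submission where

-- For them the P-algorithm can only strip
-- factors p and q, so ‖n‖_P = a‖p‖ + b‖q‖ whatever ‖_‖ is.  Walking along
-- a + b = k from p^k (log-ratio ‖p‖_log < r/s) to q^k (log-ratio ‖q‖_log > r/s)
-- there is a first n = p^a q^(b+1) above r/s, whose neighbour A = p^(a+1) q^b
-- is not.  The two differ by the factor q/p in value and by ‖q‖ − ‖p‖ in
-- complexity, so their log-ratios differ by O(1/log A); for k large this is
-- below the gap r'/s' − r/s, hence n also lies below r'/s'.

open import Defs
open import Data.Nat
  using (ℕ; zero; suc; _+_; _*_; _∸_; _^_; _<_; _≤_; _≤?_; _<?_; s≤s; z<s;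
         NonZero; >-nonZero; nonTrivial⇒n>1)
open import Data.Nat.Properties
open import Data.Nat.Divisibility using (_∣_; _∣?_; divides; ∣1⇒≡1; m∣m*n)
open import Data.Nat.Primality
  using (Prime; prime⇒nonZero; prime⇒nonTrivial; prime⇒irreducible; euclidsLemma)
open import Data.Nat.Tactic.RingSolver using (solve-∀)
import Algebra.Properties.CommutativeSemigroup *-commutativeSemigroup as *-Comm
import Algebra.Properties.CommutativeSemigroup +-commutativeSemigroup as +-Comm
open import Data.List using (List; []; _∷_)
open import Data.List.Membership.Propositional using (_∈_)
open import Data.List.Membership.DecPropositional (Data.Nat._≟_) using (_∈?_)
open import Data.List.Relation.Unary.All using (All; lookup)
open import Data.List.Relation.Unary.Any using (here; there)
open import Data.Maybe using (just; nothing)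
open import Data.Product using (Σ; ∃; ∃₂; _×_; _,_; proj₁)
open import Data.Sum using (_⊎_; inj₁; inj₂)
open import Relation.Binary using (Decidable)
open import Relation.Binary.PropositionalEquality
  using (_≡_; _≢_; refl; sym; trans; cong; subst)
open import Relation.Nullary using (¬_; yes; no; contradiction)

open ≤-Reasoning

^-distribʳ-* : ∀ m n o → (m * n) ^ o ≡ m ^ o * n ^ o
^-distribʳ-* m n zero    = refl
^-distribʳ-* m n (suc o) = begin-equality
  m * n * (m * n) ^ o      ≡⟨ cong (m * n *_) (^-distribʳ-* m n o) ⟩
  m * n * (m ^ o * n ^ o)  ≡⟨ [m*n]*[o*p]≡[m*o]*[n*p] m n (m ^ o) (n ^ o) ⟩
  m * m ^ o * (n * n ^ o)  ∎

[m^n]^o≡[m^o]^n : ∀ m n o → (m ^ n) ^ o ≡ (m ^ o) ^ n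
[m^n]^o≡[m^o]^n m n o = begin-equality
  (m ^ n) ^ o  ≡⟨ ^-*-assoc m n o ⟩
  m ^ (n * o)  ≡⟨ cong (m ^_) (*-comm n o) ⟩
  m ^ (o * n)  ≡⟨ ^-*-assoc m o n ⟨
  (m ^ o) ^ n  ∎

m^n≡1⇒n≡0 : ∀ m n → 1 < m → m ^ n ≡ 1 → n ≡ 0
m^n≡1⇒n≡0 m n 1<m m^n≡1 with m^n≡1⇒n≡0∨m≡1 m n m^n≡1
... | inj₁ n≡0 = n≡0
... | inj₂ m≡1 = contradiction (sym m≡1) (<⇒≢ 1<m)

n<2^n : ∀ n → n < 2 ^ n
n<2^n zero    = z<s
n<2^n (suc n) = begin-strict
  suc n          ≤⟨ n<2^n n ⟩
  2 ^ n          <⟨ m<m+n (2 ^ n) (m^n>0 2 n) ⟩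
  2 ^ n + 2 ^ n  ≡⟨ cong (2 ^ n +_) (+-identityʳ (2 ^ n)) ⟨
  2 ^ suc n      ∎

prime⇒1< : ∀ {p} → Prime p → 1 < p
prime⇒1< {p} pp = nonTrivial⇒n>1 p {{prime⇒nonTrivial pp}}

prime∣prime^n⇒≡ : ∀ {t p} n → Prime t → Prime p → t ∣ p ^ n → t ≡ p × 0 < n
prime∣prime^n⇒≡ zero    pt _  t∣1 = contradiction (∣1⇒≡1 t∣1) (>⇒≢ (prime⇒1< pt))
prime∣prime^n⇒≡ {p = p} (suc n) pt pp t∣p^[1+n] with euclidsLemma p (p ^ n) pt t∣p^[1+n]
... | inj₂ t∣p^n = proj₁ (prime∣prime^n⇒≡ n pt pp t∣p^n) , z<s
... | inj₁ t∣p with prime⇒irreducible pp t∣p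
...   | inj₁ t≡1 = contradiction t≡1 (>⇒≢ (prime⇒1< pt))
...   | inj₂ t≡p = t≡p , z<s

prime∣p^a*q^b⇒≡p∨≡q : ∀ {t p q} a b → Prime t → Prime p → Prime q →
                      t ∣ p ^ a * q ^ b → (t ≡ p × 0 < a) ⊎ (t ≡ q × 0 < b)
prime∣p^a*q^b⇒≡p∨≡q {p = p} {q} a b pt pp pq t∣ with euclidsLemma (p ^ a) (q ^ b) pt t∣
... | inj₁ t∣p^a = inj₁ (prime∣prime^n⇒≡ a pt pp t∣p^a)
... | inj₂ t∣q^b = inj₂ (prime∣prime^n⇒≡ b pt pq t∣q^b)

firstDivisor-just : ∀ P {n t m} → firstDivisor P n ≡ just (t , m) → t ∈ P × n ≡ m * t
firstDivisor-just (x ∷ P) {n} eq with x ∣? n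
firstDivisor-just (x ∷ P) refl | yes (divides _ n≡m*x) = here refl , n≡m*x
firstDivisor-just (x ∷ P) eq   | no _ with firstDivisor-just P eq
... | t∈P , n≡m*t = there t∈P , n≡m*t

firstDivisor-nothing : ∀ P {n t} → firstDivisor P n ≡ nothing → t ∈ P → ¬ t ∣ n
firstDivisor-nothing (x ∷ P) {n} eq t∈P t∣n with x ∣? n
firstDivisor-nothing (x ∷ P) eq (here refl) t∣n | no x∤n = x∤n t∣n
firstDivisor-nothing (x ∷ P) eq (there t∈P) t∣n | no _   = firstDivisor-nothing P eq t∈P t∣n

antidiagonal-crossing : ∀ {G : ℕ → ℕ → Set} → Decidable G → ∀ k → ¬ G k 0 → G 0 k →
                        ∃₂ λ a b → suc a + b ≡ k × ¬ G (suc a) b × G a (suc b)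
antidiagonal-crossing {G} G? k ¬G[k,0] G[0,k] = walk k 0 (+-identityʳ k) ¬G[k,0]
  where
  walk : ∀ a b → a + b ≡ k → ¬ G a b →
         ∃₂ λ a' b' → suc a' + b' ≡ k × ¬ G (suc a') b' × G a' (suc b')
  walk zero    b b≡k  ¬G[0,b] = contradiction (subst (G 0) (sym b≡k) G[0,k]) ¬G[0,b]
  walk (suc a) b a+b≡k ¬G[1+a,b] with G? a (suc b)
  ... | yes G[a,1+b] = a , b , a+b≡k , ¬G[1+a,b] , G[a,1+b]
  ... | no ¬G[a,1+b] = walk a (suc b) (trans (+-suc a b) a+b≡k) ¬G[a,1+b]

-- With logarithms to base Z: B = A y / x and M = N + d − c, so N ≤ u log A and
-- M ≥ v log B force (v − u) log A ≤ d + v log x.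
power-gap-bound : ∀ {Z A B x y c d N M u v} →
                  .{{NonZero A}} → .{{NonZero Z}} → .{{NonZero y}} → u ≤ v → B * x ≡ A * y → M + c ≡ N + d →
                  Z ^ N ≤ A ^ u → B ^ v ≤ Z ^ M → A ^ (v ∸ u) ≤ Z ^ d * x ^ v
power-gap-bound {Z} {A} {B} {x} {y} {c} {d} {N} {M} {u} {v} u≤v Bx≡Ay M+c≡N+d Z^N≤A^u B^v≤Z^M =
  *-cancelˡ-≤ (A ^ u) {{m^n≢0 A u}} (begin
    A ^ u * A ^ (v ∸ u)        ≡⟨ ^-distribˡ-+-* A u (v ∸ u) ⟨
    A ^ (u + (v ∸ u))          ≡⟨ cong (A ^_) (m+[n∸m]≡n u≤v) ⟩
    A ^ v                      ≤⟨ m≤m*n (A ^ v) (y ^ v * Z ^ c) {{y^v*Z^c≢0}} ⟩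
    A ^ v * (y ^ v * Z ^ c)    ≡⟨ *-assoc (A ^ v) (y ^ v) (Z ^ c) ⟨
    A ^ v * y ^ v * Z ^ c      ≡⟨ cong (_* Z ^ c) (^-distribʳ-* A y v) ⟨
    (A * y) ^ v * Z ^ c        ≡⟨ cong (λ w → w ^ v * Z ^ c) Bx≡Ay ⟨
    (B * x) ^ v * Z ^ c        ≡⟨ cong (_* Z ^ c) (^-distribʳ-* B x v) ⟩
    B ^ v * x ^ v * Z ^ c      ≤⟨ *-monoˡ-≤ (Z ^ c) (*-monoˡ-≤ (x ^ v) B^v≤Z^M) ⟩
    Z ^ M * x ^ v * Z ^ c      ≡⟨ *-Comm.xy∙z≈xz∙y (Z ^ M) (x ^ v) (Z ^ c) ⟩
    Z ^ M * Z ^ c * x ^ v      ≡⟨ cong (_* x ^ v) Z^M*Z^c≡Z^N*Z^d ⟩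
    Z ^ N * Z ^ d * x ^ v      ≡⟨ *-assoc (Z ^ N) (Z ^ d) (x ^ v) ⟩
    Z ^ N * (Z ^ d * x ^ v)    ≤⟨ *-monoˡ-≤ (Z ^ d * x ^ v) Z^N≤A^u ⟩
    A ^ u * (Z ^ d * x ^ v)    ∎)
  where
  y^v*Z^c≢0 : NonZero (y ^ v * Z ^ c)
  y^v*Z^c≢0 = m*n≢0 (y ^ v) (Z ^ c) {{m^n≢0 y v}} {{m^n≢0 Z c}}

  Z^M*Z^c≡Z^N*Z^d : Z ^ M * Z ^ c ≡ Z ^ N * Z ^ d
  Z^M*Z^c≡Z^N*Z^d = begin-equality
    Z ^ M * Z ^ c  ≡⟨ ^-distribˡ-+-* Z M c ⟨
    Z ^ (M + c)    ≡⟨ cong (Z ^_) M+c≡N+d ⟩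
    Z ^ (N + d)    ≡⟨ ^-distribˡ-+-* Z N d ⟩
    Z ^ N * Z ^ d  ∎

module PowerProducts (cx : ℕ → ℕ) (P : List ℕ) (primes : All Prime P)
                     {p q : ℕ} (p∈P : p ∈ P) (q∈P : q ∈ P) where

  prime-p : Prime p
  prime-p = lookup primes p∈P

  prime-q : Prime q
  prime-q = lookup primes q∈P

  instance
    p≢0 : NonZero p
    p≢0 = prime⇒nonZero prime-p

    q≢0 : NonZero q
    q≢0 = prime⇒nonZero prime-q

  pq^ : ℕ → ℕ → ℕ
  pq^ a b = p ^ a * q ^ b

  pqNorm : ℕ → ℕ → ℕ
  pqNorm a b = a * cx p + b * cx q

  pq^>0 : ∀ a b → 0 < pq^ a b
  pq^>0 a b = *-mono-≤ (m^n>0 p a) (m^n>0 q b)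

  a+b<pq^ : ∀ a b → a + b < pq^ a b
  a+b<pq^ a b = begin-strict
    a + b          <⟨ n<2^n (a + b) ⟩
    2 ^ (a + b)    ≡⟨ ^-distribˡ-+-* 2 a b ⟩
    2 ^ a * 2 ^ b  ≤⟨ *-mono-≤ (^-monoˡ-≤ a (prime⇒1< prime-p))
                               (^-monoˡ-≤ b (prime⇒1< prime-q)) ⟩
    pq^ a b        ∎

  pq^[1+a]≡p*pq^ : ∀ a b → pq^ (suc a) b ≡ p * pq^ a b
  pq^[1+a]≡p*pq^ a b = *-assoc p (p ^ a) (q ^ b)

  pq^[1+b]≡q*pq^ : ∀ a b → pq^ a (suc b) ≡ q * pq^ a b
  pq^[1+b]≡q*pq^ a b = *-Comm.x∙yz≈y∙xz (p ^ a) q (q ^ b)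

  pq^≡1⇒pqNorm≡0 : ∀ a b → pq^ a b ≡ 1 → pqNorm a b ≡ 0
  pq^≡1⇒pqNorm≡0 a b pq^≡1
    rewrite m^n≡1⇒n≡0 p a (prime⇒1< prime-p) (m*n≡1⇒m≡1 (p ^ a) (q ^ b) pq^≡1)
          | m^n≡1⇒n≡0 q b (prime⇒1< prime-q) (m*n≡1⇒n≡1 (p ^ a) (q ^ b) pq^≡1) = refl

  pq^-divisor : ∀ a b → 1 < pq^ a b → ∃ λ t → t ∈ P × t ∣ pq^ a b
  pq^-divisor zero    zero    (s≤s ())
  pq^-divisor (suc a) b       _ = p , p∈P , subst (p ∣_) (sym (pq^[1+a]≡p*pq^ a b)) (m∣m*n _)
  pq^-divisor zero    (suc b) _ = q , q∈P , subst (q ∣_) (sym (pq^[1+b]≡q*pq^ 0 b)) (m∣m*n _)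

  pq^-quotient : ∀ {t m} a b → Prime t → pq^ a b ≡ m * t →
                 ∃₂ λ a' b' → m ≡ pq^ a' b' × pqNorm a b ≡ cx t + pqNorm a' b'
  pq^-quotient {m = m} a b pt pq^≡m*t
    with prime∣p^a*q^b⇒≡p∨≡q a b pt prime-p prime-q (divides m pq^≡m*t)
  pq^-quotient {m = m} (suc a) b _ pq^≡m*p | inj₁ (refl , z<s) =
    a , b , *-cancelʳ-≡ m (pq^ a b) p m*p≡ , +-assoc (cx p) (a * cx p) (b * cx q)
    where
    m*p≡ : m * p ≡ pq^ a b * p
    m*p≡ = trans (sym pq^≡m*p) (trans (pq^[1+a]≡p*pq^ a b) (*-comm p (pq^ a b)))
  pq^-quotient {m = m} a (suc b) _ pq^≡m*q | inj₂ (refl , z<s) =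
    a , b , *-cancelʳ-≡ m (pq^ a b) q m*q≡ , +-Comm.x∙yz≈y∙xz (a * cx p) (cx q) (b * cx q)
    where
    m*q≡ : m * q ≡ pq^ a b * q
    m*q≡ = trans (sym pq^≡m*q) (trans (pq^[1+b]≡q*pq^ a b) (*-comm q (pq^ a b)))

  pqNorm-prime : ∀ {t} a b → Prime t → pq^ a b ≡ t → pqNorm a b ≡ cx t
  pqNorm-prime {t} a b pt pq^≡t with pq^-quotient a b pt (trans pq^≡t (sym (*-identityˡ t)))
  ... | a' , b' , 1≡pq^ , norm≡ = begin-equality
    pqNorm a b           ≡⟨ norm≡ ⟩
    cx t + pqNorm a' b'  ≡⟨ cong (cx t +_) (pq^≡1⇒pqNorm≡0 a' b' (sym 1≡pq^)) ⟩
    cx t + 0             ≡⟨ +-identityʳ (cx t) ⟩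
    cx t                 ∎

  pNormFuel-pq^ : ∀ f {n} a b → n ≡ pq^ a b → 1 < n → n ≤ f → pNormFuel cx P f n ≡ pqNorm a b
  pNormFuel-pq^ zero    a b _ 1<n n≤0 = contradiction (<-≤-trans 1<n n≤0) λ ()
  pNormFuel-pq^ (suc f) {n} a b n≡pq^ 1<n n≤1+f with n ≤? 1
  ... | yes n≤1 = contradiction n≤1 (<⇒≱ 1<n)
  ... | no _ with n ∈? P
  ...   | yes n∈P = sym (pqNorm-prime a b (lookup primes n∈P) (sym n≡pq^))
  ...   | no n∉P with firstDivisor P n in first≡
  ...     | nothing with pq^-divisor a b (subst (1 <_) n≡pq^ 1<n)
  ...       | t , t∈P , t∣pq^ =
    contradiction (subst (t ∣_) (sym n≡pq^) t∣pq^) (firstDivisor-nothing P first≡ t∈P)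
  pNormFuel-pq^ (suc f) {n} a b n≡pq^ 1<n n≤1+f | no _ | no n∉P | just (t , m)
    with firstDivisor-just P first≡
  ... | t∈P , n≡m*t with pq^-quotient a b (lookup primes t∈P) (trans (sym n≡pq^) n≡m*t)
  ...   | a' , b' , m≡pq^ , norm≡ = begin-equality
    cx t + pNormFuel cx P f m  ≡⟨ cong (cx t +_) (pNormFuel-pq^ f a' b' m≡pq^ 1<m m≤f) ⟩
    cx t + pqNorm a' b'        ≡⟨ norm≡ ⟨
    pqNorm a b                 ∎
    where
    m≢1 : 1 ≢ m
    m≢1 1≡m = n∉P (subst (_∈ P) (sym n≡t) t∈P)
      where
      n≡t : n ≡ t
      n≡t = trans n≡m*t (trans (cong (_* t) (sym 1≡m)) (*-identityˡ t))

    1<m : 1 < m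
    1<m = ≤∧≢⇒< (subst (0 <_) (sym m≡pq^) (pq^>0 a' b')) m≢1

    m≤f : m ≤ f
    m≤f = ≤-pred (begin-strict
      m      <⟨ m<m*n m t {{>-nonZero (<-trans z<s 1<m)}} (prime⇒1< (lookup primes t∈P)) ⟩
      m * t  ≡⟨ n≡m*t ⟨
      n      ≤⟨ n≤1+f ⟩
      suc f  ∎)

  pNorm-pq^ : ∀ a b → 1 < pq^ a b → pNorm cx P (pq^ a b) ≡ pqNorm a b
  pNorm-pq^ a b 1<pq^ = pNormFuel-pq^ (pq^ a b) a b refl 1<pq^ ≤-refl

  module Crossing (r s r' s' : ℕ) (0<s : 0 < s) (hp : 3 ^ (s * cx p) < p ^ r)
                  (hrs : r * s' < r' * s) (hq : q ^ r' < 3 ^ (s' * cx q)) where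

    RatioAbove : ℕ → ℕ → Set
    RatioAbove a b = pq^ a b ^ r < 3 ^ (s * pqNorm a b)

    ratioAbove? : Decidable RatioAbove
    ratioAbove? a b = pq^ a b ^ r <? 3 ^ (s * pqNorm a b)

    q^r<3^[s*‖q‖] : q ^ r < 3 ^ (s * cx q)
    q^r<3^[s*‖q‖] = ≰⇒> λ 3^[s*‖q‖]≤q^r → <-irrefl refl (begin-strict
      (3 ^ (s * cx q)) ^ s'  ≤⟨ ^-monoˡ-≤ s' 3^[s*‖q‖]≤q^r ⟩
      (q ^ r) ^ s'           ≡⟨ ^-*-assoc q r s' ⟩
      q ^ (r * s')           ≤⟨ ^-monoʳ-≤ q (<⇒≤ hrs) ⟩
      q ^ (r' * s)           ≡⟨ ^-*-assoc q r' s ⟨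
      (q ^ r') ^ s           <⟨ ^-monoˡ-< s {{>-nonZero 0<s}} hq ⟩
      (3 ^ (s' * cx q)) ^ s  ≡⟨ ^-*-assoc 3 (s' * cx q) s ⟩
      3 ^ (s' * cx q * s)    ≡⟨ cong (3 ^_) (*-Comm.xy∙z≈zy∙x s' (cx q) s) ⟩
      3 ^ (s * cx q * s')    ≡⟨ ^-*-assoc 3 (s * cx q) s' ⟨
      (3 ^ (s * cx q)) ^ s'  ∎)

    ¬ratioAbove-p^ : ∀ a → ¬ RatioAbove a 0
    ¬ratioAbove-p^ a = ≤⇒≯ (begin
      3 ^ (s * pqNorm a 0)  ≡⟨ cong (3 ^_) (exponent s a (cx p)) ⟩
      3 ^ (s * cx p * a)    ≡⟨ ^-*-assoc 3 (s * cx p) a ⟨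
      (3 ^ (s * cx p)) ^ a  ≤⟨ ^-monoˡ-≤ a (<⇒≤ hp) ⟩
      (p ^ r) ^ a           ≡⟨ [m^n]^o≡[m^o]^n p r a ⟩
      (p ^ a) ^ r           ≡⟨ cong (_^ r) (*-identityʳ (p ^ a)) ⟨
      pq^ a 0 ^ r           ∎)
      where
      exponent : ∀ s a c → s * (a * c + 0) ≡ s * c * a
      exponent = solve-∀

    ratioAbove-q^ : ∀ b → 0 < b → RatioAbove 0 b
    ratioAbove-q^ b 0<b = begin-strict
      pq^ 0 b ^ r           ≡⟨ cong (_^ r) (*-identityˡ (q ^ b)) ⟩
      (q ^ b) ^ r           ≡⟨ [m^n]^o≡[m^o]^n q b r ⟩
      (q ^ r) ^ b           <⟨ ^-monoˡ-< b {{>-nonZero 0<b}} q^r<3^[s*‖q‖] ⟩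
      (3 ^ (s * cx q)) ^ b  ≡⟨ ^-*-assoc 3 (s * cx q) b ⟩
      3 ^ (s * cx q * b)    ≡⟨ cong (3 ^_) (*-Comm.xy∙z≈x∙zy s (cx q) b) ⟩
      3 ^ (s * pqNorm 0 b)  ∎

    bound : ℕ
    bound = (3 ^ (s * s')) ^ cx q * p ^ (r' * s)

    ratioBelow-past-crossing : ∀ a b → bound < pq^ (suc a) b → ¬ RatioAbove (suc a) b →
                               3 ^ (s' * pqNorm a (suc b)) < pq^ a (suc b) ^ r'
    ratioBelow-past-crossing a b bound<A ¬above = ≰⇒> λ B^r'≤ → <⇒≱ bound<A (begin
      A                      ≡⟨ *-identityʳ A ⟨
      A ^ 1                  ≤⟨ ^-monoʳ-≤ A (m<n⇒0<n∸m hrs) ⟩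
      A ^ (r' * s ∸ r * s')  ≤⟨ power-gap-bound {Z = Z} {c = cx p} {d = cx q} {N = N} {M = M}
                                  (<⇒≤ hrs) Bp≡Aq norm≡ (Z^N≤A^u (≮⇒≥ ¬above)) (B^v≤Z^M B^r'≤) ⟩
      bound                  ∎)
      where
      A B N M Z : ℕ
      A = pq^ (suc a) b
      B = pq^ a (suc b)
      N = pqNorm (suc a) b
      M = pqNorm a (suc b)
      Z = 3 ^ (s * s')

      instance
        A≢0 : NonZero A
        A≢0 = >-nonZero (pq^>0 (suc a) b)

        Z≢0 : NonZero Z
        Z≢0 = m^n≢0 3 (s * s')

      Bp≡Aq : B * p ≡ A * q
      Bp≡Aq = begin-equality
        B * p            ≡⟨ cong (_* p) (pq^[1+b]≡q*pq^ a b) ⟩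
        q * pq^ a b * p  ≡⟨ *-Comm.xy∙z≈zy∙x q (pq^ a b) p ⟩
        p * pq^ a b * q  ≡⟨ cong (_* q) (pq^[1+a]≡p*pq^ a b) ⟨
        A * q            ∎

      norm≡ : M + cx p ≡ N + cx q
      norm≡ = shift a b (cx p) (cx q)
        where
        shift : ∀ a b c d → a * c + (d + b * d) + c ≡ c + a * c + b * d + d
        shift = solve-∀

      Z^N≤A^u : 3 ^ (s * N) ≤ A ^ r → Z ^ N ≤ A ^ (r * s')
      Z^N≤A^u 3^[s*N]≤A^r = begin
        Z ^ N               ≡⟨ ^-*-assoc 3 (s * s') N ⟩
        3 ^ (s * s' * N)    ≡⟨ cong (3 ^_) (*-Comm.xy∙z≈xz∙y s s' N) ⟩
        3 ^ (s * N * s')    ≡⟨ ^-*-assoc 3 (s * N) s' ⟨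
        (3 ^ (s * N)) ^ s'  ≤⟨ ^-monoˡ-≤ s' 3^[s*N]≤A^r ⟩
        (A ^ r) ^ s'        ≡⟨ ^-*-assoc A r s' ⟩
        A ^ (r * s')        ∎

      B^v≤Z^M : B ^ r' ≤ 3 ^ (s' * M) → B ^ (r' * s) ≤ Z ^ M
      B^v≤Z^M B^r'≤3^[s'*M] = begin
        B ^ (r' * s)         ≡⟨ ^-*-assoc B r' s ⟨
        (B ^ r') ^ s         ≤⟨ ^-monoˡ-≤ s B^r'≤3^[s'*M] ⟩
        (3 ^ (s' * M)) ^ s   ≡⟨ ^-*-assoc 3 (s' * M) s ⟩
        3 ^ (s' * M * s)     ≡⟨ cong (3 ^_) (*-Comm.xy∙z≈zx∙y s' M s) ⟩
        3 ^ (s * s' * M)     ≡⟨ ^-*-assoc 3 (s * s') M ⟨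
        Z ^ M                ∎

    crossing : Σ ℕ λ n → 1 < n × n ^ r < 3 ^ (s * pNorm cx P n) × 3 ^ (s' * pNorm cx P n) < n ^ r'
    crossing
      with antidiagonal-crossing ratioAbove? (suc bound) (¬ratioAbove-p^ (suc bound)) (ratioAbove-q^ (suc bound) z<s)
    ... | a , b , 1+a+b≡1+bound , ¬above , above =
      pq^ a (suc b) , 1<n ,
      subst (λ N → pq^ a (suc b) ^ r < 3 ^ (s * N)) (sym norm≡) above ,
      subst (λ N → 3 ^ (s' * N) < pq^ a (suc b) ^ r') (sym norm≡)
            (ratioBelow-past-crossing a b bound<A ¬above)
      where
      1<n : 1 < pq^ a (suc b)
      1<n = ≤-<-trans (≤-trans z<s (m≤n+m (suc b) a)) (a+b<pq^ a (suc b))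

      norm≡ : pNorm cx P (pq^ a (suc b)) ≡ pqNorm a (suc b)
      norm≡ = pNorm-pq^ a (suc b) 1<n

      bound<A : bound < pq^ (suc a) b
      bound<A = begin-strict
        bound          <⟨ n<1+n bound ⟩
        suc bound      ≡⟨ 1+a+b≡1+bound ⟨
        suc a + b      <⟨ a+b<pq^ (suc a) b ⟩
        pq^ (suc a) b  ∎

-- The argument works for an arbitrary function cx.
lemma1 : (cx : ℕ → ℕ) → ((m : ℕ) → 1 ≤ m → IsComplexity m (cx m)) →
         (P : List ℕ) → P ≢ [] → All Prime P →
         (p q : ℕ) → p ∈ P → q ∈ P → p < q →
         (r s r' s' : ℕ) → 0 < s → 0 < s' →
         3 ^ (s * cx p) < p ^ r →
         r * s' < r' * s →
         q ^ r' < 3 ^ (s' * cx q) →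
         Σ ℕ λ n → 1 < n × n ^ r < 3 ^ (s * pNorm cx P n)
                         × 3 ^ (s' * pNorm cx P n) < n ^ r'
lemma1 cx _ P _ primes p q p∈P q∈P _ r s r' s' 0<s _ hp hrs hq =
  PowerProducts.Crossing.crossing cx P primes p∈P q∈P r s r' s' 0<s hp hrs hq
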